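{- Let $E$ be a finite equational system, $>$ a reduction order, and $(E_0,\varnothing,H_0)\leadsto^n(E_n,R,H_n)$ a (not necessarily successful) run of recording completion for $E$. Then for all terms $s,t$ with a join $s\to^*_R\cdot\leftarrow^*_R t$, the recall procedure applied to this join terminates and produces a conversion between $s$ and $t$ all of whose steps use equations of $E_0$ (apart from trivial steps $x\approx x$ labelled $0$); in particular $s\leftrightarrow^*_{E}t$.
   Context: Terms are first-order terms. Equations $s\approx t$ and rules $s\to t$ carry unique indices (natural numbers); $s\xrightarrow{i}_R t$ is a rewrite step with the rule of index $i$. A history is a set of entries $i\colon s\overset{j}{\circ_1}u\overset{k}{\circ_2}t$ with $\circ_1,\circ_2\in\{\leftarrow,\to,\approx\}$. Inference rules of recording completion on triples $(E,R,H)$ ($m$ a fresh index larger than every index used before; $>$ the fixed reduction order): (deduce) $(E,R,H)\leadsto(E\cup\{m\colon s\approx t\},R,H\cup\{m\colon s\overset{j}{\leftarrow}u\overset{k}{\to}t\})$ if $s\xleftarrow{j}_R u\xrightarrow{k}_R t$; (orient-l) $(E\cup\{i\colon s\approx t\},R,H)\leadsto(E,R\cup\{i\colon s\to t\},H)$ if $s>t$; (orient-r) $(E\cup\{i\colon s\approx t\},R,H\cup\{i\colon s\overset{j}{\circ_1}u\overset{k}{\circ_2}t\})\leadsto(E,R\cup\{i\colon t\to s\},H\cup\{i\colon t\,(\overset{k}{\circ_2})^{ -1}\,u\,(\overset{j}{\circ_1})^{ -1}\,s\})$ if $t>s$; (simplify-l) $(E\cup\{i\colon s\approx t\},R,H)\leadsto(E\cup\{m\colon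 u\approx t\},R,H\cup\{m\colon u\overset{l}{\leftarrow}s\overset{i}{\to}t\})$ if $s\xrightarrow{l}_R u$; (simplify-r) $(E\cup\{i\colon s\approx t\},R,H)\leadsto(E\cup\{m\colon s\approx u\},R,H\cup\{m\colon s\overset{i}{\to}t\overset{l}{\to}u\})$ if $t\xrightarrow{l}_R u$; (delete) $(E\cup\{i\colon s\approx s\},R,H\cup\{i\colon s\circ_1 v\circ_2 s\})\leadsto(E,R,H)$; (compose) $(E,R\cup\{i\colon s\to t\},H)\leadsto(E,R\cup\{m\colon s\to u\},H\cup\{m\colon s\overset{i}{\to}t\overset{j}{\to}u\})$ if $t\xrightarrow{j}_R u$; (collapse) $(E,R\cup\{i\colon s\to t\},H)\leadsto(E\cup\{m\colon u\approx t\},R,H\cup\{m\colon u\overset{j}{\leftarrow}s\overset{i}{\to}t\})$ if $s\xrightarrow{j}_R u$. A run for $E$ is a finite sequence of such applications starting from $E_0=\{i\colon s\approx t\mid s\approx t\in E\}$ (fresh index per equation), $R_0=\varnothing$, $H_0=\{i\colon s\overset{i}{\to}t\overset{0}{\approx}t\mid i\colon s\approx t\in E_0\}$. Recall procedure: given a conversion (initially the join), repeatedly take a step $t_1\xrightarrow{i}t_2$ (or its reverse) whose index $i$ is not an index of $E_0$; let $i\colon\ell\to r$ be the rule with index $i$, $i\colon\ell\overset{j}{\circ_1}u\overset{k}{\circ_2}r$ the history entry with index $i$ in $H_n$, and $p$, $\sigma$ a position and substitution with $t_1|_p=\ell\sigma$, $t_2|_p=r\sigma$; replace the step by $t_1\overset{j}{\circ_1}t_1[u\sigma]_p\overset{k}{\circ_2}t_2$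 (steps labelled $j,k$ again referring to equations/rules with those indices at position $p$ with substitution $\sigma$). -}

module Defs where

open import Data.Nat using (ℕ; zero; suc; _≤_; _⊔_)
open import Data.Vec using (Vec; []; _∷_)
open import Data.List using (List; []; _∷_; map; foldr)
open import Data.List.Membership.Propositional using (_∈_)
open import Data.List.Relation.Binary.Permutation.Propositional using (_↭_)
open import Data.Maybe using (Maybe; just; nothing)
open import Data.Product using (Σ; _×_; _,_)
open import Data.Sum using (_⊎_)
open import Relation.Binary.PropositionalEquality using (_≡_)
open import Relation.Nullary using (¬_)
open import Relation.Binary.Construct.Closure.ReflexiveTransitive using (Star)
open import Induction.WellFounded using (WellFounded)

module Rewriting (F : Set) (ar : F → ℕ) (V : Set) where

  data Term : Set where
    var : V → Term
    fun : (f : F) → Vec Term (ar f) → Term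

  Subst : Set
  Subst = V → Term

  mutual
    _⟪_⟫ : Term → Subst → Term
    var x ⟪ σ ⟫ = σ x
    fun f ts ⟪ σ ⟫ = fun f (substs ts σ)

    substs : ∀ {n} → Vec Term n → Subst → Vec Term n
    substs [] σ = []
    substs (t ∷ ts) σ = (t ⟪ σ ⟫) ∷ substs ts σ

  -- positions: sequences of (0-based) argument indices
  Pos : Set
  Pos = List ℕ

  mutual
    _∣_ : Term → Pos → Maybe Term
    t ∣ [] = just t
    var x ∣ (i ∷ p) = nothing
    fun f ts ∣ (i ∷ p) = subAt ts i p

    subAt : ∀ {n} → Vec Term n → ℕ → Pos → Maybe Term
    subAt [] i p = nothing
    subAt (t ∷ ts) zero p = t ∣ p
    subAt (t ∷ ts) (suc i) p = subAt ts i p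

  mutual
    _[_≔_] : Term → Pos → Term → Maybe Term
    t [ [] ≔ u ] = just u
    var x [ i ∷ p ≔ u ] = nothing
    fun f ts [ i ∷ p ≔ u ] with replAt ts i p u
    ... | just ts' = just (fun f ts')
    ... | nothing = nothing

    replAt : ∀ {n} → Vec Term n → ℕ → Pos → Term → Maybe (Vec Term n)
    replAt [] i p u = nothing
    replAt (t ∷ ts) zero p u with t [ p ≔ u ]
    ... | just t' = just (t' ∷ ts)
    ... | nothing = nothing
    replAt (t ∷ ts) (suc i) p u with replAt ts i p u
    ... | just ts' = just (t ∷ ts')
    ... | nothing = nothing

  record IsReductionOrder (_≻_ : Term → Term → Set) : Set where
    field
      irrefl : ∀ {s} → ¬ (s ≻ s)
      trans  : ∀ {s t u} → s ≻ t → t ≻ u → s ≻ u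
      wf     : WellFounded (λ s t → t ≻ s)
      ctx    : ∀ {s t c c₁ c₂} (p : Pos) → s ≻ t →
               c [ p ≔ s ] ≡ just c₁ → c [ p ≔ t ] ≡ just c₂ → c₁ ≻ c₂
      stable : ∀ {s t} (σ : Subst) → s ≻ t → (s ⟪ σ ⟫) ≻ (t ⟪ σ ⟫)

  At : Pos → Subst → Term → Term → Term → Term → Set
  At p σ ℓ r a b = (a ∣ p ≡ just (ℓ ⟪ σ ⟫)) × (a [ p ≔ r ⟪ σ ⟫ ] ≡ just b)

  -- indexed equations / rules  i : s ≈ t  resp.  i : s → t
  record IEq : Set where
    constructor ie
    field
      idx : ℕ
      lhs : Term
      rhs : Term

  RStep : List IEq → ℕ → Term → Term → Set
  RStep R i a b = Σ Term λ ℓ → Σ Term λ r → (ie i ℓ r ∈ R) ×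
                  Σ Pos λ p → Σ Subst λ σ → At p σ ℓ r a b

  EStep : List (Term × Term) → Term → Term → Set
  EStep E a b = Σ Term λ ℓ → Σ Term λ r → ((ℓ , r) ∈ E) ×
                Σ Pos λ p → Σ Subst λ σ → At p σ ℓ r a b

  EConv : List (Term × Term) → Term → Term → Set
  EConv E = Star (λ a b → EStep E a b ⊎ EStep E b a)

  unlabel : List IEq → List (Term × Term)
  unlabel = map (λ e → IEq.lhs e , IEq.rhs e)

  data Dir : Set where
    bwd fwd eqv : Dir

  inv : Dir → Dir
  inv bwd = fwd
  inv fwd = bwd
  inv eqv = eqv

  -- history entry  i : s ∘₁^j u ∘₂^k t
  record HEntry : Set where
    constructor he
    field
      idx : ℕ
      lhs : Term
      c₁  : Dir
      j   : ℕ
      mid : Term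
      c₂  : Dir
      k   : ℕ
      rhs : Term

  -- states (E, R, H) together with the least index not used so far
  record State : Set where
    constructor st
    field
      eqs   : List IEq
      rules : List IEq
      hist  : List HEntry
      next  : ℕ

  maxIdx : List IEq → ℕ
  maxIdx = foldr (λ e m → IEq.idx e ⊔ m) 0

  -- (E₀, ∅, H₀); indices 0..maxIdx E₀ (including the trivial label 0) count as used
  init : List IEq → State
  init E₀ = st E₀ [] (map (λ e → he (IEq.idx e) (IEq.lhs e) fwd (IEq.idx e) (IEq.rhs e) eqv 0 (IEq.rhs e)) E₀)
               (suc (maxIdx E₀))

  -- recording completion; "m fresh" is  next ≤ m , afterwards next = m + 1
  module Completion (_≻_ : Term → Term → Set) where

    data _⇝_ : State → State → Set where
      deduce : ∀ {E R H n s u t j k m} →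
        RStep R j u s → RStep R k u t → n ≤ m →
        st E R H n ⇝ st (ie m s t ∷ E) R (he m s bwd j u fwd k t ∷ H) (suc m)
      orient-l : ∀ {E E' R H n i s t} →
        E ↭ (ie i s t ∷ E') → s ≻ t →
        st E R H n ⇝ st E' (ie i s t ∷ R) H n
      orient-r : ∀ {E E' R H H' n i s t u c₁ c₂ j k} →
        E ↭ (ie i s t ∷ E') → H ↭ (he i s c₁ j u c₂ k t ∷ H') → t ≻ s →
        st E R H n ⇝ st E' (ie i t s ∷ R) (he i t (inv c₂) k u (inv c₁) j s ∷ H') n
      simplify-l : ∀ {E E' R H n i s t u l m} →
        E ↭ (ie i s t ∷ E') → RStep R l s u → n ≤ m →
        st E R H n ⇝ st (ie m u t ∷ E') R (he m u bwd l s fwd i t ∷ H) (suc m)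
      simplify-r : ∀ {E E' R H n i s t u l m} →
        E ↭ (ie i s t ∷ E') → RStep R l t u → n ≤ m →
        st E R H n ⇝ st (ie m s u ∷ E') R (he m s fwd i t fwd l u ∷ H) (suc m)
      delete : ∀ {E E' R H H' n i s v c₁ c₂ j k} →
        E ↭ (ie i s s ∷ E') → H ↭ (he i s c₁ j v c₂ k s ∷ H') →
        st E R H n ⇝ st E' R H' n
      compose : ∀ {E R R' H n i s t u j m} →
        R ↭ (ie i s t ∷ R') → RStep R' j t u → n ≤ m →
        st E R H n ⇝ st E (ie m s u ∷ R') (he m s fwd i t fwd j u ∷ H) (suc m)
      collapse : ∀ {E R R' H n i s t u j m} →
        R ↭ (ie i s t ∷ R') → RStep R' j s u → n ≤ m →
        st E R H n ⇝ st (ie m u t ∷ E) R' (he m u bwd j s fwd i t ∷ H) (suc m)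

  data Conv : Term → Term → Set where
    []   : ∀ {a} → Conv a a
    step : ∀ {c} (a : Term) (d : Dir) (i : ℕ) (b : Term) → Conv b c → Conv a c

  mutual
    data IsJoin (R : List IEq) : ∀ {s t} → Conv s t → Set where
      fwd-step : ∀ {a b c i} {C : Conv b c} → RStep R i a b → IsJoin R C →
                 IsJoin R (step a fwd i b C)
      to-bwd   : ∀ {s t} {C : Conv s t} → IsBwd R C → IsJoin R C

    data IsBwd (R : List IEq) : ∀ {s t} → Conv s t → Set where
      []       : ∀ {a} → IsBwd R ([] {a})
      bwd-step : ∀ {a b c i} {C : Conv b c} → RStep R i b a → IsBwd R C →
                 IsBwd R (step a bwd i b C)

  data Recall (E₀ : List IEq) (H : List HEntry) : ∀ {s t} → Conv s t → Conv s t → Set where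
    here-fwd : ∀ {a b c i t} {C : Conv b t} {h : HEntry} {p σ} →
      ¬ (i ∈ map IEq.idx E₀) → h ∈ H → HEntry.idx h ≡ i →
      At p σ (HEntry.lhs h) (HEntry.rhs h) a b →
      a [ p ≔ HEntry.mid h ⟪ σ ⟫ ] ≡ just c →
      Recall E₀ H (step a fwd i b C)
                  (step a (HEntry.c₁ h) (HEntry.j h) c (step c (HEntry.c₂ h) (HEntry.k h) b C))
    here-bwd : ∀ {a b c i t} {C : Conv b t} {h : HEntry} {p σ} →
      ¬ (i ∈ map IEq.idx E₀) → h ∈ H → HEntry.idx h ≡ i →
      At p σ (HEntry.lhs h) (HEntry.rhs h) b a →
      b [ p ≔ HEntry.mid h ⟪ σ ⟫ ] ≡ just c →
      Recall E₀ H (step a bwd i b C)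
                  (step a (inv (HEntry.c₂ h)) (HEntry.k h) c (step c (inv (HEntry.c₁ h)) (HEntry.j h) b C))
    there : ∀ {a b t d i} {C C' : Conv b t} →
      Recall E₀ H C C' → Recall E₀ H (step a d i b C) (step a d i b C')

  RecallNF : List IEq → List HEntry → ∀ {s t} → Conv s t → Set
  RecallNF E₀ H C = ∀ C' → ¬ Recall E₀ H C C'

  data E₀Conv (E₀ : List IEq) : ∀ {s t} → Conv s t → Set where
    []      : ∀ {a} → E₀Conv E₀ ([] {a})
    trivial : ∀ {a t} {C : Conv a t} → E₀Conv E₀ C → E₀Conv E₀ (step a eqv 0 a C)
    eq-step : ∀ {a b t d i ℓ r p σ} {C : Conv b t} → ie i ℓ r ∈ E₀ →
              At p σ ℓ r a b ⊎ At p σ ℓ r b a → E₀Conv E₀ C →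
              E₀Conv E₀ (step a d i b C)

module Submission where

-- Call an index derived if it is not the index of an original equation (of E₀),
-- and call a labelled step valid w.r.t. a history H if it is an instance of the
-- original equation with its label, or if its label i is derived and the step is
-- an instance of the end points ℓ → r of an entry i : ℓ ∘ u ∘ r of H.
--
--  * Invariant of runs: every equation and rule is justified (original, or
--    recorded in H with its index); every entry with a derived index i consists
--    of two valid steps whose labels are smaller than i; no entry uses the index
--    of a current equation as a label; indices of E ∪ R are distinct and all
--    indices are below the next free one.  Each inference rule is a composition
--    of elementary operations (adding or removing an equation, rule or entry)
--    that preserve the invariant.
--  * Hence a join over R consists of valid steps, and recall keeps conversions
--    valid.  Recall replaces a label i by two labels below i, so the weight
--    Σ 3^i of a conversion decreases: recall terminates.
--  * A valid step with a derived label can always be expanded, so in a recall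
--    normal form every step is an original equation step, which also gives s ↔*_E t.
--
-- Lemmas about positions and substitutions, needed to move steps into contexts,
-- come first.  The reduction order and the hypothesis that original indices are
-- non-zero play no role.

open import Defs
open import Data.Nat using (ℕ; zero; suc; _+_; _^_; _<_; _≤_; s≤s)
open import Data.Nat.Properties
  using (<-irrefl; <-≤-trans; <-trans; <⇒≢; ≤-trans; ≤-pred; m≤n⇒m≤1+n; n<1+n; m≤m⊔n; m≤n⊔m;
         m<m+n; +-assoc; +-identityʳ; +-mono-≤; +-monoˡ-<; +-monoʳ-<; ^-monoʳ-≤; m^n>0;
         module ≤-Reasoning)
open import Data.Nat.Induction using (<-wellFounded)
open import Data.Vec using (Vec; []; _∷_)
open import Data.List using (List; []; _∷_; _++_; map)
open import Data.List.Properties using (++-identityʳ)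
open import Data.List.Membership.Propositional using (_∈_)
open import Data.List.Membership.Propositional.Properties
  using (∈-map⁺; ∈-map⁻; ∈-++⁺ˡ; ∈-++⁺ʳ; ∈-++⁻)
open import Data.List.Relation.Unary.Any using (here; there)
open import Data.List.Relation.Unary.All using (All; lookup; tabulate)
import Data.List.Relation.Unary.AllPairs as AllPairs
open import Data.List.Relation.Unary.AllPairs using (_∷_)
open import Data.List.Relation.Unary.Unique.Propositional using (Unique)
open import Data.List.Relation.Binary.Permutation.Propositional
  using (_↭_; ↭-refl; ↭-prep; ↭-swap; ↭-sym; ↭-trans; ↭⇒↭ₛ)
open import Data.List.Relation.Binary.Permutation.Propositional.Properties
  using (∈-resp-↭; map⁺; ++⁺ˡ; ++⁺ʳ; shift)
import Data.List.Relation.Binary.Permutation.Setoid.Properties as PermutationProperties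
open import Data.Sum using (_⊎_; inj₁; inj₂)
import Data.Sum
open import Data.Empty using (⊥-elim)
open import Relation.Nullary using (¬_)
open import Relation.Binary.Construct.Closure.ReflexiveTransitive using (Star; ε; _◅_)
open import Induction.WellFounded using (Acc; acc; module Subrelation)
import Relation.Binary.Construct.On as On
open import Data.Maybe using (just)
open import Data.Product using (Σ; _×_; _,_; proj₁; proj₂; swap)
open import Relation.Binary.PropositionalEquality
  using (_≡_; _≢_; refl; sym; trans; cong; cong₂; subst; setoid; ≢-sym; module ≡-Reasoning)

module Positions (F : Set) (ar : F → ℕ) (V : Set) where
  open Rewriting F ar V

  mutual
    subterm-replace : ∀ t p u {t'} → t [ p ≔ u ] ≡ just t' → t' ∣ p ≡ just u
    subterm-replace t [] u refl = refl
    subterm-replace (fun f ts) (i ∷ p) u eq with replAt ts i p u in e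
    subterm-replace (fun f ts) (i ∷ p) u refl | just ts' = subterm-replace* ts i p u e

    subterm-replace* : ∀ {n} (ts : Vec Term n) i p u {ts'} →
                       replAt ts i p u ≡ just ts' → subAt ts' i p ≡ just u
    subterm-replace* (t ∷ ts) zero p u eq with t [ p ≔ u ] in e
    subterm-replace* (t ∷ ts) zero p u refl | just t' = subterm-replace t p u e
    subterm-replace* (t ∷ ts) (suc i) p u eq with replAt ts i p u in e
    subterm-replace* (t ∷ ts) (suc i) p u refl | just ts' = subterm-replace* ts i p u e

  mutual
    replace-self : ∀ t p {u} → t ∣ p ≡ just u → t [ p ≔ u ] ≡ just t
    replace-self t [] refl = refl
    replace-self (fun f ts) (i ∷ p) eq rewrite replace-self* ts i p eq = refl

    replace-self* : ∀ {n} (ts : Vec Term n) i p {u} → subAt ts i p ≡ just u →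
                    replAt ts i p u ≡ just ts
    replace-self* (t ∷ ts) zero p eq rewrite replace-self t p eq = refl
    replace-self* (t ∷ ts) (suc i) p eq rewrite replace-self* ts i p eq = refl

  mutual
    replace-replace : ∀ t p u v {t'} → t [ p ≔ u ] ≡ just t' → t' [ p ≔ v ] ≡ t [ p ≔ v ]
    replace-replace t [] u v refl = refl
    replace-replace (fun f ts) (i ∷ p) u v eq with replAt ts i p u in e
    replace-replace (fun f ts) (i ∷ p) u v refl | just ts' rewrite replace-replace* ts i p u v e = refl

    replace-replace* : ∀ {n} (ts : Vec Term n) i p u v {ts'} →
                       replAt ts i p u ≡ just ts' → replAt ts' i p v ≡ replAt ts i p v
    replace-replace* (t ∷ ts) zero p u v eq with t [ p ≔ u ] in e
    replace-replace* (t ∷ ts) zero p u v refl | just t' rewrite replace-replace t p u v e = refl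
    replace-replace* (t ∷ ts) (suc i) p u v eq with replAt ts i p u in e
    replace-replace* (t ∷ ts) (suc i) p u v refl | just ts' rewrite replace-replace* ts i p u v e = refl

  mutual
    replace-defined : ∀ t p {u} v → t ∣ p ≡ just u → Σ Term λ t' → t [ p ≔ v ] ≡ just t'
    replace-defined t [] v refl = v , refl
    replace-defined (fun f ts) (i ∷ p) v eq with replAt ts i p v | replace-defined* ts i p v eq
    ... | just ts' | _ = fun f ts' , refl

    replace-defined* : ∀ {n} (ts : Vec Term n) i p {u} v → subAt ts i p ≡ just u →
                       Σ (Vec Term n) λ ts' → replAt ts i p v ≡ just ts'
    replace-defined* (t ∷ ts) zero p v eq with t [ p ≔ v ] | replace-defined t p v eq
    ... | just t' | _ = t' ∷ ts , refl
    replace-defined* (t ∷ ts) (suc i) p v eq with replAt ts i p v | replace-defined* ts i p v eq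
    ... | just ts' | _ = t ∷ ts' , refl

  mutual
    subterm-++ : ∀ t p q {u} → t ∣ p ≡ just u → t ∣ (p ++ q) ≡ u ∣ q
    subterm-++ t [] q refl = refl
    subterm-++ (fun f ts) (i ∷ p) q eq = subterm-++* ts i p q eq

    subterm-++* : ∀ {n} (ts : Vec Term n) i p q {u} → subAt ts i p ≡ just u →
                  subAt ts i (p ++ q) ≡ u ∣ q
    subterm-++* (t ∷ ts) zero p q eq = subterm-++ t p q eq
    subterm-++* (t ∷ ts) (suc i) p q eq = subterm-++* ts i p q eq

  mutual
    replace-++ : ∀ t p q {u u' v t'} → t ∣ p ≡ just u → u [ q ≔ v ] ≡ just u' →
                 t [ p ≔ u' ] ≡ just t' → t [ p ++ q ≔ v ] ≡ just t'
    replace-++ t [] q refl e₂ refl = e₂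
    replace-++ (fun f ts) (i ∷ p) q {u' = u'} e₁ e₂ e₃ with replAt ts i p u' in e
    replace-++ (fun f ts) (i ∷ p) q e₁ e₂ refl | just ts'
      rewrite replace-++* ts i p q e₁ e₂ e = refl

    replace-++* : ∀ {n} (ts : Vec Term n) i p q {u u' v ts'} → subAt ts i p ≡ just u →
                  u [ q ≔ v ] ≡ just u' → replAt ts i p u' ≡ just ts' →
                  replAt ts i (p ++ q) v ≡ just ts'
    replace-++* (t ∷ ts) zero p q {u' = u'} e₁ e₂ e₃ with t [ p ≔ u' ] in e
    replace-++* (t ∷ ts) zero p q e₁ e₂ refl | just t' rewrite replace-++ t p q e₁ e₂ e = refl
    replace-++* (t ∷ ts) (suc i) p q {u' = u'} e₁ e₂ e₃ with replAt ts i p u' in e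
    replace-++* (t ∷ ts) (suc i) p q e₁ e₂ refl | just ts'
      rewrite replace-++* ts i p q e₁ e₂ e = refl

  mutual
    subterm-subst : ∀ t q σ {w} → t ∣ q ≡ just w → (t ⟪ σ ⟫) ∣ q ≡ just (w ⟪ σ ⟫)
    subterm-subst t [] σ refl = refl
    subterm-subst (fun f ts) (i ∷ q) σ eq = subterm-subst* ts i q σ eq

    subterm-subst* : ∀ {n} (ts : Vec Term n) i q σ {w} → subAt ts i q ≡ just w →
                     subAt (substs ts σ) i q ≡ just (w ⟪ σ ⟫)
    subterm-subst* (t ∷ ts) zero q σ eq = subterm-subst t q σ eq
    subterm-subst* (t ∷ ts) (suc i) q σ eq = subterm-subst* ts i q σ eq

  mutual
    replace-subst : ∀ t q v σ {t'} → t [ q ≔ v ] ≡ just t' →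
                    (t ⟪ σ ⟫) [ q ≔ v ⟪ σ ⟫ ] ≡ just (t' ⟪ σ ⟫)
    replace-subst t [] v σ refl = refl
    replace-subst (fun f ts) (i ∷ q) v σ eq with replAt ts i q v in e
    replace-subst (fun f ts) (i ∷ q) v σ refl | just ts' rewrite replace-subst* ts i q v σ e = refl

    replace-subst* : ∀ {n} (ts : Vec Term n) i q v σ {ts'} → replAt ts i q v ≡ just ts' →
                     replAt (substs ts σ) i q (v ⟪ σ ⟫) ≡ just (substs ts' σ)
    replace-subst* (t ∷ ts) zero q v σ eq with t [ q ≔ v ] in e
    replace-subst* (t ∷ ts) zero q v σ refl | just t' rewrite replace-subst t q v σ e = refl
    replace-subst* (t ∷ ts) (suc i) q v σ eq with replAt ts i q v in e
    replace-subst* (t ∷ ts) (suc i) q v σ refl | just ts' rewrite replace-subst* ts i q v σ e = refl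

  _∘ˢ_ : Subst → Subst → Subst
  (τ ∘ˢ σ) x = τ x ⟪ σ ⟫

  mutual
    subst-∘ : ∀ t τ σ → t ⟪ τ ⟫ ⟪ σ ⟫ ≡ t ⟪ τ ∘ˢ σ ⟫
    subst-∘ (var x) τ σ = refl
    subst-∘ (fun f ts) τ σ = cong (fun f) (subst-∘* ts τ σ)

    subst-∘* : ∀ {n} (ts : Vec Term n) τ σ → substs (substs ts τ) σ ≡ substs ts (τ ∘ˢ σ)
    subst-∘* [] τ σ = refl
    subst-∘* (t ∷ ts) τ σ = cong₂ _∷_ (subst-∘ t τ σ) (subst-∘* ts τ σ)

  mutual
    subst-id : ∀ t → t ⟪ var ⟫ ≡ t
    subst-id (var x) = refl
    subst-id (fun f ts) = cong (fun f) (subst-id* ts)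

    subst-id* : ∀ {n} (ts : Vec Term n) → substs ts var ≡ ts
    subst-id* [] = refl
    subst-id* (t ∷ ts) = cong₂ _∷_ (subst-id t) (subst-id* ts)

  -- Recall splits a step a → b at p into a → c → b through c = a[u]_p.
  replace-middle : ∀ {b c} a p u v → a [ p ≔ v ] ≡ just b → a [ p ≔ u ] ≡ just c →
                   c ∣ p ≡ just u × c [ p ≔ v ] ≡ just b
  replace-middle a p u v a[p≔v] a[p≔u] =
    subterm-replace a p u a[p≔u] , trans (replace-replace a p u v a[p≔u]) a[p≔v]

  -- The rewrite relation At packaged as a record, so that its position,
  -- substitution and rule can be inferred from its type.
  record Inst (p : Pos) (σ : Subst) (ℓ r a b : Term) : Set where
    constructor inst
    field at : At p σ ℓ r a b

  open Inst public

  Inst-sym : ∀ {p σ ℓ r a b} → Inst p σ ℓ r a b → Inst p σ r ℓ b a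
  Inst-sym {p} {σ} {ℓ} {r} {a} (inst (a∣p , a[p≔rσ])) =
    inst (replace-middle a p (r ⟪ σ ⟫) (ℓ ⟪ σ ⟫) (replace-self a p a∣p) a[p≔rσ])

  Inst-lift : ∀ {q τ ℓ r x y a c} p σ → Inst q τ ℓ r x y →
              a ∣ p ≡ just (x ⟪ σ ⟫) → a [ p ≔ y ⟪ σ ⟫ ] ≡ just c →
              Inst (p ++ q) (τ ∘ˢ σ) ℓ r a c
  Inst-lift {q} {τ} {ℓ} {r} {x} {y} {a} {c} p σ (inst (x∣q , x[q≔rτ])) a∣p a[p≔yσ] =
    inst (subterm , replacement)
    where
      open ≡-Reasoning
      subterm : a ∣ (p ++ q) ≡ just (ℓ ⟪ τ ∘ˢ σ ⟫)
      subterm = begin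
        a ∣ (p ++ q)           ≡⟨ subterm-++ a p q a∣p ⟩
        (x ⟪ σ ⟫) ∣ q          ≡⟨ subterm-subst x q σ x∣q ⟩
        just (ℓ ⟪ τ ⟫ ⟪ σ ⟫)   ≡⟨ cong just (subst-∘ ℓ τ σ) ⟩
        just (ℓ ⟪ τ ∘ˢ σ ⟫)    ∎
      replacement : a [ p ++ q ≔ r ⟪ τ ∘ˢ σ ⟫ ] ≡ just c
      replacement =
        subst (λ z → a [ p ++ q ≔ z ] ≡ just c) (subst-∘ r τ σ)
                    (replace-++ a p q a∣p (replace-subst x q (r ⟪ τ ⟫) σ x[q≔rτ]) a[p≔yσ])

  Inst-lift-sym : ∀ {q τ ℓ r x y a c} p σ → Inst q τ ℓ r y x →
                  a ∣ p ≡ just (x ⟪ σ ⟫) → a [ p ≔ y ⟪ σ ⟫ ] ≡ just c →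
                  Inst (p ++ q) (τ ∘ˢ σ) ℓ r c a
  Inst-lift-sym p σ s a∣p a[p≔yσ] = Inst-sym (Inst-lift p σ (Inst-sym s) a∣p a[p≔yσ])

  Inst-root : ∀ ℓ r → Inst [] var ℓ r ℓ r
  Inst-root ℓ r = inst (cong just (sym (subst-id ℓ)) , cong just (subst-id r))

unique-↭ : ∀ {xs ys : List ℕ} → xs ↭ ys → Unique xs → Unique ys
unique-↭ p = PermutationProperties.Unique-resp-↭ (setoid ℕ) (↭⇒↭ₛ p)

head∈ : ∀ {A : Set} {L L' : List A} {x} → L ↭ x ∷ L' → x ∈ L
head∈ p = ∈-resp-↭ (↭-sym p) (here refl)

rest⊆ : ∀ {A : Set} {L L' : List A} {x e} → L ↭ x ∷ L' → e ∈ L' → e ∈ L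
rest⊆ p e∈L' = ∈-resp-↭ (↭-sym p) (there e∈L')

∈-split : ∀ {A : Set} {L L' : List A} {x e} → L ↭ x ∷ L' → e ∈ L → e ≡ x ⊎ e ∈ L'
∈-split p e∈L with ∈-resp-↭ p e∈L
... | here e≡x = inj₁ e≡x
... | there e∈L' = inj₂ e∈L'

unique-disjoint : ∀ {A : Set} (f : A → ℕ) xs {ys a b} → Unique (map f (xs ++ ys)) →
                  a ∈ xs → b ∈ ys → f a ≢ f b
unique-disjoint f (x ∷ xs) (fx∉ ∷ _) (here refl) b∈ys = lookup fx∉ (∈-map⁺ f (∈-++⁺ʳ xs b∈ys))
unique-disjoint f (x ∷ xs) (_ ∷ u) (there a∈xs) b∈ys = unique-disjoint f xs u a∈xs b∈ys

module Recording (F : Set) (ar : F → ℕ) (V : Set)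
                 (_≻_ : Rewriting.Term F ar V → Rewriting.Term F ar V → Set)
                 (E₀ : List (Rewriting.IEq F ar V)) where
  open Rewriting F ar V
  open Positions F ar V
  open Completion _≻_
  open IEq using (idx)

  Derived : ℕ → Set
  Derived i = ¬ (i ∈ map idx E₀)

  data Valid (H : List HEntry) (a : Term) : Dir → ℕ → Term → Set where
    original    : ∀ {d i b ℓ r p σ} → ie i ℓ r ∈ E₀ →
                  Inst p σ ℓ r a b ⊎ Inst p σ ℓ r b a → Valid H a d i b
    derived-fwd : ∀ {i b h p σ} → Derived i → h ∈ H → HEntry.idx h ≡ i →
                  Inst p σ (HEntry.lhs h) (HEntry.rhs h) a b → Valid H a fwd i b
    derived-bwd : ∀ {i b h p σ} → Derived i → h ∈ H → HEntry.idx h ≡ i →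
                  Inst p σ (HEntry.lhs h) (HEntry.rhs h) b a → Valid H a bwd i b

  valid-sym : ∀ {H a d i b} → Valid H a d i b → Valid H b (inv d) i a
  valid-sym (original e (inj₁ s)) = original e (inj₂ s)
  valid-sym (original e (inj₂ s)) = original e (inj₁ s)
  valid-sym (derived-fwd d h∈H refl s) = derived-bwd d h∈H refl s
  valid-sym (derived-bwd d h∈H refl s) = derived-fwd d h∈H refl s

  valid-lift : ∀ {H x d j y a c} p σ → Valid H x d j y →
               a ∣ p ≡ just (x ⟪ σ ⟫) → a [ p ≔ y ⟪ σ ⟫ ] ≡ just c → Valid H a d j c
  valid-lift p σ (original e (inj₁ s)) x∣p x[p] = original e (inj₁ (Inst-lift p σ s x∣p x[p]))
  valid-lift p σ (original e (inj₂ s)) x∣p x[p] = original e (inj₂ (Inst-lift-sym p σ s x∣p x[p]))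
  valid-lift p σ (derived-fwd d h∈H eq s) x∣p x[p] = derived-fwd d h∈H eq (Inst-lift p σ s x∣p x[p])
  valid-lift p σ (derived-bwd d h∈H eq s) x∣p x[p] = derived-bwd d h∈H eq (Inst-lift-sym p σ s x∣p x[p])

  Retains : List HEntry → List HEntry → ℕ → Set
  Retains H H' i = Derived i → ∀ {h} → h ∈ H → HEntry.idx h ≡ i → h ∈ H'

  retains-∷ : ∀ {H h i} → Retains H (h ∷ H) i
  retains-∷ _ h∈H _ = there h∈H

  retains-removal : ∀ {H H' h i} → H ↭ h ∷ H' → i ≢ HEntry.idx h → Retains H H' i
  retains-removal p i≢ _ h'∈H refl with ∈-split p h'∈H
  ... | inj₁ refl = ⊥-elim (i≢ refl)
  ... | inj₂ h'∈H' = h'∈H'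

  valid-transport : ∀ {H H' a d j b} → Retains H H' j → Valid H a d j b → Valid H' a d j b
  valid-transport keep (original e s) = original e s
  valid-transport keep (derived-fwd d h∈H eq s) = derived-fwd d (keep d h∈H eq) eq s
  valid-transport keep (derived-bwd d h∈H eq s) = derived-bwd d (keep d h∈H eq) eq s

  data Justified (H : List HEntry) : IEq → Set where
    original     : ∀ {i ℓ r} → ie i ℓ r ∈ E₀ → Justified H (ie i ℓ r)
    original-sym : ∀ {i ℓ r} → ie i r ℓ ∈ E₀ → Justified H (ie i ℓ r)
    derived      : ∀ {h} → Derived (HEntry.idx h) → h ∈ H →
                   Justified H (ie (HEntry.idx h) (HEntry.lhs h) (HEntry.rhs h))

  justified-transport : ∀ {H H' e} → Retains H H' (idx e) → Justified H e → Justified H' e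
  justified-transport keep (original e) = original e
  justified-transport keep (original-sym e) = original-sym e
  justified-transport keep (derived d h∈H) = derived d (keep d h∈H refl)

  justified-step : ∀ {H i ℓ r p σ a b} → Justified H (ie i ℓ r) → Inst p σ ℓ r a b →
                   Valid H a fwd i b
  justified-step (original e) s = original e (inj₁ s)
  justified-step (original-sym e) s = original e (inj₂ (Inst-sym s))
  justified-step (derived d h∈H) s = derived-fwd d h∈H refl s

  justified-root : ∀ {H i ℓ r} → Justified H (ie i ℓ r) → Valid H ℓ fwd i r
  justified-root {ℓ = ℓ} {r} j = justified-step j (Inst-root ℓ r)

  rule-step : ∀ {R H j a b} → (∀ {e} → e ∈ R → Justified H e) → RStep R j a b →
              Valid H a fwd j b
  rule-step justR (_ , _ , e∈R , p , σ , s) = justified-step {p = p} {σ} (justR e∈R) (inst s)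

  rule-index : ∀ {R j a b} {P : ℕ → Set} → (∀ {e} → e ∈ R → P (idx e)) →
               RStep R j a b → P j
  rule-index all (_ , _ , e∈R , _) = all e∈R

  Recallable : List HEntry → HEntry → Set
  Recallable H (he i s c₁ j u c₂ k t) =
    Derived i → Valid H s c₁ j u × Valid H u c₂ k t × j < i × k < i

  RetainsLabels : List HEntry → List HEntry → HEntry → Set
  RetainsLabels H H' h = Derived (HEntry.idx h) → Retains H H' (HEntry.j h) × Retains H H' (HEntry.k h)

  recallable-transport : ∀ {H H' h} → RetainsLabels H H' h → Recallable H h → Recallable H' h
  recallable-transport keep rec d with rec d | keep d
  ... | v₁ , v₂ , j< , k< | keepj , keepk =
    valid-transport keepj v₁ , valid-transport keepk v₂ , j< , k<

  Avoids : HEntry → ℕ → Set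
  Avoids h i = HEntry.j h ≢ i × HEntry.k h ≢ i

  FreshFor : ℕ → List IEq → List IEq → Set
  FreshFor i E R = All (i ≢_) (map idx (E ++ R))

  fresh-E : ∀ {i E R e} → FreshFor i E R → e ∈ E → i ≢ idx e
  fresh-E f e∈E = lookup f (∈-map⁺ idx (∈-++⁺ˡ e∈E))

  fresh-R : ∀ {i E R e} → FreshFor i E R → e ∈ R → i ≢ idx e
  fresh-R {E = E} f e∈R = lookup f (∈-map⁺ idx (∈-++⁺ʳ E e∈R))

  record Invariant (E R : List IEq) (H : List HEntry) (n : ℕ) : Set where
    field
      justifiedE     : ∀ {e} → e ∈ E → Justified H e
      justifiedR     : ∀ {e} → e ∈ R → Justified H e
      recallable     : ∀ {h} → h ∈ H → Recallable H h
      entry-below    : ∀ {h} → h ∈ H → HEntry.idx h < n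
      original-below : ∀ {i} → i ∈ map idx E₀ → i < n
      distinct       : Unique (map idx (E ++ R))
      unreferenced   : ∀ {e h} → e ∈ E → h ∈ H → Derived (HEntry.idx h) → Avoids h (idx e)

  open Invariant

  label-below : ∀ {E R H n a d j b} → Invariant E R H n → Valid H a d j b → j < n
  label-below I (original e _) = original-below I (∈-map⁺ idx e)
  label-below I (derived-fwd _ h∈H refl _) = entry-below I h∈H
  label-below I (derived-bwd _ h∈H refl _) = entry-below I h∈H

  justified-below : ∀ {E R H n e} → Invariant E R H n → Justified H e → idx e < n
  justified-below I (original e) = original-below I (∈-map⁺ idx e)
  justified-below I (original-sym e) = original-below I (∈-map⁺ idx e)
  justified-below I (derived _ h∈H) = entry-below I h∈H

  fresh-derived : ∀ {E R H n m} → Invariant E R H n → n ≤ m → Derived m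
  fresh-derived I n≤m m∈E₀ = <-irrefl refl (<-≤-trans (original-below I m∈E₀) n≤m)

  fresh-object : ∀ {E R H n m} → Invariant E R H n → n ≤ m → FreshFor m E R
  fresh-object {E} {R} {m = m} I n≤m = tabulate fresh
    where
      fresh : ∀ {i} → i ∈ map idx (E ++ R) → m ≢ i
      fresh i∈ with ∈-map⁻ idx i∈
      ... | e , e∈ , refl with ∈-++⁻ E e∈
      ... | inj₁ e∈E = ≢-sym (<⇒≢ (<-≤-trans (justified-below I (justifiedE I e∈E)) n≤m))
      ... | inj₂ e∈R = ≢-sym (<⇒≢ (<-≤-trans (justified-below I (justifiedR I e∈R)) n≤m))

  fresh-avoided : ∀ {E R H n m h} → Invariant E R H n → n ≤ m → h ∈ H →
                  Derived (HEntry.idx h) → Avoids h m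
  fresh-avoided {m = m} {h} I n≤m h∈H d with recallable I h∈H d
  ... | _ , _ , j< , k< = <⇒≢ (<-trans j< below) , <⇒≢ (<-trans k< below)
    where
      below : HEntry.idx h < m
      below = <-≤-trans (entry-below I h∈H) n≤m

  rule-not-equation : ∀ {E R H n j a b e} → Invariant E R H n → RStep R j a b → e ∈ E →
                      j ≢ idx e
  rule-not-equation {E} I rs e∈E =
    rule-index (λ e'∈R j≡ → unique-disjoint idx E (distinct I) e∈E e'∈R (sym j≡)) rs

  equation-split : ∀ {E E' R H n e} → Invariant E R H n → E ↭ e ∷ E' →
                   Unique (map idx (e ∷ (E' ++ R)))
  equation-split {R = R} I p = unique-↭ (map⁺ idx (++⁺ʳ R p)) (distinct I)

  rule-split : ∀ {E R R' H n e} → Invariant E R H n → R ↭ e ∷ R' →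
               Unique (map idx (e ∷ (E ++ R')))
  rule-split {E} {R' = R'} {e = e} I p =
    unique-↭ (map⁺ idx (↭-trans (++⁺ˡ E p) (shift e E R'))) (distinct I)

  equation-fresh : ∀ {E E' R H n e} → Invariant E R H n → E ↭ e ∷ E' → FreshFor (idx e) E' R
  equation-fresh I p = AllPairs.head (equation-split I p)

  rule-fresh : ∀ {E R R' H n e} → Invariant E R H n → R ↭ e ∷ R' → FreshFor (idx e) E R'
  rule-fresh I p = AllPairs.head (rule-split I p)

  raise : ∀ {E R H n m} → Invariant E R H n → n ≤ m → Invariant E R H m
  raise I n≤m = record
    { justifiedE = justifiedE I
    ; justifiedR = justifiedR I
    ; recallable = recallable I
    ; entry-below = λ h∈H → <-≤-trans (entry-below I h∈H) n≤m
    ; original-below = λ i∈ → <-≤-trans (original-below I i∈) n≤m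
    ; distinct = distinct I
    ; unreferenced = unreferenced I }

  add-entry : ∀ {E R H n h} → Invariant E R H n → HEntry.idx h < n → Recallable H h →
              (∀ {e} → e ∈ E → Derived (HEntry.idx h) → Avoids h (idx e)) →
              Invariant E R (h ∷ H) n
  add-entry I below rec avoids = record
    { justifiedE = λ e∈E → justified-transport retains-∷ (justifiedE I e∈E)
    ; justifiedR = λ e∈R → justified-transport retains-∷ (justifiedR I e∈R)
    ; recallable = λ { (here refl) → weaken rec ; (there h∈H) → weaken (recallable I h∈H) }
    ; entry-below = λ { (here refl) → below ; (there h∈H) → entry-below I h∈H }
    ; original-below = original-below I
    ; distinct = distinct I
    ; unreferenced = λ { e∈E (here refl) → avoids e∈E
                       ; e∈E (there h∈H) → unreferenced I e∈E h∈H } }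
    where
      weaken : ∀ {h'} → Recallable _ h' → Recallable (_ ∷ _) h'
      weaken = recallable-transport (λ _ → retains-∷ , retains-∷)

  add-equation : ∀ {E R H n e} → Invariant E R H n → Justified H e → FreshFor (idx e) E R →
                 (∀ {h} → h ∈ H → Derived (HEntry.idx h) → Avoids h (idx e)) →
                 Invariant (e ∷ E) R H n
  add-equation I justification fresh avoided = record
    { justifiedE = λ { (here refl) → justification ; (there e∈E) → justifiedE I e∈E }
    ; justifiedR = justifiedR I
    ; recallable = recallable I
    ; entry-below = entry-below I
    ; original-below = original-below I
    ; distinct = fresh ∷ distinct I
    ; unreferenced = λ { (here refl) → avoided ; (there e∈E) → unreferenced I e∈E } }

  add-rule : ∀ {E R H n e} → Invariant E R H n → Justified H e → FreshFor (idx e) E R →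
             Invariant E (e ∷ R) H n
  add-rule {E} {R} {e = e} I justification fresh = record
    { justifiedE = justifiedE I
    ; justifiedR = λ { (here refl) → justification ; (there e∈R) → justifiedR I e∈R }
    ; recallable = recallable I
    ; entry-below = entry-below I
    ; original-below = original-below I
    ; distinct = unique-↭ (map⁺ idx (↭-sym (shift e E R))) (fresh ∷ distinct I)
    ; unreferenced = unreferenced I }

  remove-equation : ∀ {E E' R H n e} → Invariant E R H n → E ↭ e ∷ E' → Invariant E' R H n
  remove-equation I p = record
    { justifiedE = λ e∈E' → justifiedE I (rest⊆ p e∈E')
    ; justifiedR = justifiedR I
    ; recallable = recallable I
    ; entry-below = entry-below I
    ; original-below = original-below I
    ; distinct = AllPairs.tail (equation-split I p)
    ; unreferenced = λ e∈E' → unreferenced I (rest⊆ p e∈E') }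

  remove-rule : ∀ {E R R' H n e} → Invariant E R H n → R ↭ e ∷ R' → Invariant E R' H n
  remove-rule I p = record
    { justifiedE = justifiedE I
    ; justifiedR = λ e∈R' → justifiedR I (rest⊆ p e∈R')
    ; recallable = recallable I
    ; entry-below = entry-below I
    ; original-below = original-below I
    ; distinct = AllPairs.tail (rule-split I p)
    ; unreferenced = unreferenced I }

  remove-entry : ∀ {E R H H' n h} → Invariant E R H n → H ↭ h ∷ H' →
                 FreshFor (HEntry.idx h) E R →
                 (∀ {h'} → h' ∈ H' → Derived (HEntry.idx h') → Avoids h' (HEntry.idx h)) →
                 Invariant E R H' n
  remove-entry I p fresh avoids = record
    { justifiedE = λ e∈E → justified-transport (retains-object (fresh-E fresh e∈E)) (justifiedE I e∈E)
    ; justifiedR = λ e∈R → justified-transport (retains-object (fresh-R fresh e∈R)) (justifiedR I e∈R)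
    ; recallable = λ h'∈H' → recallable-transport (retains h'∈H') (recallable I (rest⊆ p h'∈H'))
    ; entry-below = λ h'∈H' → entry-below I (rest⊆ p h'∈H')
    ; original-below = original-below I
    ; distinct = distinct I
    ; unreferenced = λ e∈E h'∈H' → unreferenced I e∈E (rest⊆ p h'∈H') }
    where
      retains-object : ∀ {i} → _ ≢ i → Retains _ _ i
      retains-object fresh = retains-removal p (≢-sym fresh)

      retains : ∀ {h'} → h' ∈ _ → RetainsLabels _ _ h'
      retains h'∈H' d with avoids h'∈H' d
      ... | j≢ , k≢ = retains-removal p j≢ , retains-removal p k≢

  record-entry : ∀ {E R H n m a c₁ j b c₂ k c} → Invariant E R H n → n ≤ m →
                 Valid H a c₁ j b → Valid H b c₂ k c →
                 (∀ {e} → e ∈ E → Avoids (he m a c₁ j b c₂ k c) (idx e)) →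
                 Invariant E R (he m a c₁ j b c₂ k c ∷ H) (suc m)
  record-entry {m = m} {j = j} {k = k} I n≤m v₁ v₂ avoids =
    add-entry (raise I (m≤n⇒m≤1+n n≤m)) (n<1+n m)
              (λ _ → v₁ , v₂ , j<m , k<m)
              (λ e∈E _ → avoids e∈E)
    where
      j<m : j < m
      j<m = <-≤-trans (label-below I v₁) n≤m
      k<m : k < m
      k<m = <-≤-trans (label-below I v₂) n≤m

  record-equation : ∀ {E R H n m a c₁ j b c₂ k c} → Invariant E R H n → n ≤ m →
                    Valid H a c₁ j b → Valid H b c₂ k c →
                    (∀ {e} → e ∈ E → Avoids (he m a c₁ j b c₂ k c) (idx e)) →
                    Invariant (ie m a c ∷ E) R (he m a c₁ j b c₂ k c ∷ H) (suc m)
  record-equation I n≤m v₁ v₂ avoids =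
    add-equation (record-entry I n≤m v₁ v₂ avoids) (derived (fresh-derived I n≤m) (here refl))
                 (fresh-object I n≤m) avoided
    where
      avoided : ∀ {h} → h ∈ _ → Derived (HEntry.idx h) → Avoids h _
      avoided (here refl) _ =
        <⇒≢ (<-≤-trans (label-below I v₁) n≤m) , <⇒≢ (<-≤-trans (label-below I v₂) n≤m)
      avoided (there h∈H) d = fresh-avoided I n≤m h∈H d

  record-rule : ∀ {E R H n m a c₁ j b c₂ k c} → Invariant E R H n → n ≤ m →
                Valid H a c₁ j b → Valid H b c₂ k c →
                (∀ {e} → e ∈ E → Avoids (he m a c₁ j b c₂ k c) (idx e)) →
                Invariant E (ie m a c ∷ R) (he m a c₁ j b c₂ k c ∷ H) (suc m)
  record-rule I n≤m v₁ v₂ avoids =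
    add-rule (record-entry I n≤m v₁ v₂ avoids) (derived (fresh-derived I n≤m) (here refl))
             (fresh-object I n≤m)

  justified-reverse : ∀ {H H' i s t c₁ j u c₂ k} → Justified H (ie i s t) →
                      Justified (he i t c₁ j u c₂ k s ∷ H') (ie i t s)
  justified-reverse (original e) = original-sym e
  justified-reverse (original-sym e) = original e
  justified-reverse (derived d _) = derived d (here refl)

  orient-invariant : ∀ {E E' R H H' n i s t u c₁ c₂ j k} → Invariant E R H n →
                     E ↭ ie i s t ∷ E' → H ↭ he i s c₁ j u c₂ k t ∷ H' →
                     Invariant E' (ie i t s ∷ R) (he i t (inv c₂) k u (inv c₁) j s ∷ H') n
  orient-invariant {E} {E'} {R} {H} {H'} {n} {i} {s} {t} {u} {c₁} {c₂} {j} {k} I pE pH =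
    add-rule without-old (justified-reverse (justifiedE I (head∈ pE))) (equation-fresh I pE)
    where
      reversed : HEntry
      reversed = he i t (inv c₂) k u (inv c₁) j s

      reversed-recallable : Recallable H reversed
      reversed-recallable d with recallable I (head∈ pH) d
      ... | v₁ , v₂ , j< , k< = valid-sym v₂ , valid-sym v₁ , k< , j<

      with-reversed : Invariant E R (reversed ∷ H) n
      with-reversed = add-entry I (entry-below I (head∈ pH)) reversed-recallable
                        (λ e∈E d → swap (unreferenced I e∈E (head∈ pH) d))

      avoids : ∀ {h'} → h' ∈ reversed ∷ H' → Derived (HEntry.idx h') → Avoids h' i
      avoids (here refl) d with recallable I (head∈ pH) d
      ... | _ , _ , j< , k< = <⇒≢ k< , <⇒≢ j<
      avoids (there h'∈H') d = unreferenced I (head∈ pE) (rest⊆ pH h'∈H') d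

      without-old : Invariant E' R (reversed ∷ H') n
      without-old = remove-entry (remove-equation with-reversed pE)
                      (↭-trans (↭-prep reversed pH) (↭-swap reversed _ ↭-refl))
                      (equation-fresh I pE) avoids

  InvariantS : State → Set
  InvariantS (st E R H n) = Invariant E R H n

  step-invariant : ∀ {S S'} → S ⇝ S' → InvariantS S → InvariantS S'
  step-invariant (deduce r₁ r₂ n≤m) I =
    record-equation I n≤m (valid-sym (rule-step (justifiedR I) r₁)) (rule-step (justifiedR I) r₂)
                    (λ e∈E → rule-not-equation I r₁ e∈E , rule-not-equation I r₂ e∈E)
  step-invariant (orient-l pE _) I =
    add-rule (remove-equation I pE) (justifiedE I (head∈ pE)) (equation-fresh I pE)
  step-invariant (orient-r pE pH _) I = orient-invariant I pE pH
  step-invariant (simplify-l {E' = E'} {R} {H} {n} pE rs n≤m) I =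
    record-equation I' n≤m (valid-sym (rule-step (justifiedR I') rs))
                    (justified-root (justifiedE I (head∈ pE)))
                    (λ e∈E' → rule-not-equation I' rs e∈E' , fresh-E (equation-fresh I pE) e∈E')
    where
      I' : Invariant E' R H n
      I' = remove-equation I pE
  step-invariant (simplify-r {E' = E'} {R} {H} {n} pE rs n≤m) I =
    record-equation I' n≤m (justified-root (justifiedE I (head∈ pE))) (rule-step (justifiedR I') rs)
                    (λ e∈E' → fresh-E (equation-fresh I pE) e∈E' , rule-not-equation I' rs e∈E')
    where
      I' : Invariant E' R H n
      I' = remove-equation I pE
  step-invariant (delete pE pH) I =
    remove-entry (remove-equation I pE) pH (equation-fresh I pE)
                 (λ h'∈H' d → unreferenced I (head∈ pE) (rest⊆ pH h'∈H') d)
  step-invariant (compose {E} {R' = R'} {H = H} {n} pR rs n≤m) I =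
    record-rule I' n≤m (justified-root (justifiedR I (head∈ pR))) (rule-step (justifiedR I') rs)
                (λ e∈E → fresh-E (rule-fresh I pR) e∈E , rule-not-equation I' rs e∈E)
    where
      I' : Invariant E R' H n
      I' = remove-rule I pR
  step-invariant (collapse {E} {R' = R'} {H = H} {n} pR rs n≤m) I =
    record-equation I' n≤m (valid-sym (rule-step (justifiedR I') rs))
                    (justified-root (justifiedR I (head∈ pR)))
                    (λ e∈E → rule-not-equation I' rs e∈E , fresh-E (rule-fresh I pR) e∈E)
    where
      I' : Invariant E R' H n
      I' = remove-rule I pR

  run-invariant : ∀ {S S'} → Star _⇝_ S S' → InvariantS S → InvariantS S'
  run-invariant ε I = I
  run-invariant (s⇝ ◅ run) I = run-invariant run (step-invariant s⇝ I)

  initial-entry-original : ∀ {h} → h ∈ State.hist (init E₀) → HEntry.idx h ∈ map idx E₀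
  initial-entry-original h∈H₀ with ∈-map⁻ _ h∈H₀
  ... | e , e∈E₀ , refl = ∈-map⁺ idx e∈E₀

  below-max : ∀ {L e} → e ∈ L → idx e ≤ maxIdx L
  below-max {x ∷ L} (here refl) = m≤m⊔n (idx x) (maxIdx L)
  below-max {x ∷ L} (there e∈L) = ≤-trans (below-max e∈L) (m≤n⊔m (idx x) (maxIdx L))

  original-below-init : ∀ {i} → i ∈ map idx E₀ → i < suc (maxIdx E₀)
  original-below-init i∈ with ∈-map⁻ idx i∈
  ... | e , e∈E₀ , refl = s≤s (below-max e∈E₀)

  init-invariant : Unique (map idx E₀) → InvariantS (init E₀)
  init-invariant distinct₀ = record
    { justifiedE = original
    ; justifiedR = λ ()
    ; recallable = λ h∈H₀ d → ⊥-elim (d (initial-entry-original h∈H₀))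
    ; entry-below = λ h∈H₀ → original-below-init (initial-entry-original h∈H₀)
    ; original-below = original-below-init
    ; distinct = subst (λ L → Unique (map idx L)) (sym (++-identityʳ E₀)) distinct₀
    ; unreferenced = λ _ h∈H₀ d → ⊥-elim (d (initial-entry-original h∈H₀)) }

  module Recalling (H : List HEntry) (recallable : ∀ {h} → h ∈ H → Recallable H h) where

    data ValidConv : ∀ {s t} → Conv s t → Set where
      []  : ∀ {a} → ValidConv ([] {a})
      _∷_ : ∀ {a d i b t} {C : Conv b t} → Valid H a d i b → ValidConv C →
            ValidConv (step a d i b C)

    mutual
      join-valid : ∀ {R s t} {J : Conv s t} → (∀ {e} → e ∈ R → Justified H e) → IsJoin R J →
                   ValidConv J
      join-valid justR (fwd-step rs J) = rule-step justR rs ∷ join-valid justR J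
      join-valid justR (to-bwd J) = bwd-valid justR J

      bwd-valid : ∀ {R s t} {J : Conv s t} → (∀ {e} → e ∈ R → Justified H e) → IsBwd R J →
                  ValidConv J
      bwd-valid justR [] = []
      bwd-valid justR (bwd-step rs J) = valid-sym (rule-step justR rs) ∷ bwd-valid justR J

    recall-valid : ∀ {s t} {C C' : Conv s t} → Recall E₀ H C C' → ValidConv C → ValidConv C'
    recall-valid (here-fwd {a} {b} {c} {h = h} {p} {σ} d h∈H refl at a[p≔u]) (_ ∷ vs)
      with recallable h∈H d
    ... | v₁ , v₂ , _ , _ =
      valid-lift p σ v₁ (proj₁ at) a[p≔u] ∷ valid-lift p σ v₂ (proj₁ middle) (proj₂ middle) ∷ vs
      where
        middle : c ∣ p ≡ just (HEntry.mid h ⟪ σ ⟫) × c [ p ≔ HEntry.rhs h ⟪ σ ⟫ ] ≡ just b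
        middle = replace-middle a p (HEntry.mid h ⟪ σ ⟫) (HEntry.rhs h ⟪ σ ⟫) (proj₂ at) a[p≔u]
    recall-valid (here-bwd {a} {b} {c} {h = h} {p} {σ} d h∈H refl at b[p≔u]) (_ ∷ vs)
      with recallable h∈H d
    ... | v₁ , v₂ , _ , _ =
      valid-sym (valid-lift p σ v₂ (proj₁ middle) (proj₂ middle)) ∷
      valid-sym (valid-lift p σ v₁ (proj₁ at) b[p≔u]) ∷ vs
      where
        middle : c ∣ p ≡ just (HEntry.mid h ⟪ σ ⟫) × c [ p ≔ HEntry.rhs h ⟪ σ ⟫ ] ≡ just a
        middle = replace-middle b p (HEntry.mid h ⟪ σ ⟫) (HEntry.rhs h ⟪ σ ⟫) (proj₂ at) b[p≔u]
    recall-valid (there r) (v ∷ vs) = v ∷ recall-valid r vs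

    recalls-valid : ∀ {s t} {C C' : Conv s t} → Star (Recall E₀ H) C C' → ValidConv C →
                    ValidConv C'
    recalls-valid ε vs = vs
    recalls-valid (r ◅ rs) vs = recalls-valid rs (recall-valid r vs)

    -- Termination: a step labelled i weighs 3^i; recall replaces it by two
    -- steps with smaller labels, which weigh less in total.
    weight : ∀ {s t} → Conv s t → ℕ
    weight [] = 0
    weight (step a d i b C) = 3 ^ i + weight C

    three-powers : ∀ {i j k} → j < i → k < i → 3 ^ j + 3 ^ k < 3 ^ i
    three-powers {suc i} {j} {k} j<i k<i = begin-strict
      3 ^ j + 3 ^ k  ≤⟨ +-mono-≤ (^-monoʳ-≤ 3 (≤-pred j<i)) (^-monoʳ-≤ 3 (≤-pred k<i)) ⟩
      x + x          <⟨ m<m+n (x + x) (m^n>0 3 i) ⟩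
      x + x + x      ≡⟨ trans (+-assoc x x x) (cong (λ y → x + (x + y)) (sym (+-identityʳ x))) ⟩
      3 ^ suc i      ∎
      where
        open ≤-Reasoning
        x : ℕ
        x = 3 ^ i

    split-weight : ∀ {i j k} w → j < i → k < i → 3 ^ j + (3 ^ k + w) < 3 ^ i + w
    split-weight {i} {j} {k} w j<i k<i = begin-strict
      3 ^ j + (3 ^ k + w)  ≡⟨ sym (+-assoc (3 ^ j) (3 ^ k) w) ⟩
      3 ^ j + 3 ^ k + w    <⟨ +-monoˡ-< w (three-powers j<i k<i) ⟩
      3 ^ i + w            ∎
      where open ≤-Reasoning

    recall-decreases : ∀ {s t} {C C' : Conv s t} → Recall E₀ H C C' → weight C' < weight C
    recall-decreases (here-fwd {C = C} d h∈H refl _ _) with recallable h∈H d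
    ... | _ , _ , j<i , k<i = split-weight (weight C) j<i k<i
    recall-decreases (here-bwd {C = C} d h∈H refl _ _) with recallable h∈H d
    ... | _ , _ , j<i , k<i = split-weight (weight C) k<i j<i
    recall-decreases (there {i = i} r) = +-monoʳ-< (3 ^ i) (recall-decreases r)

    recall-terminates : ∀ {s t} (C : Conv s t) → Acc (λ C' C → Recall E₀ H C C') C
    recall-terminates = Subrelation.wellFounded recall-decreases (On.wellFounded weight <-wellFounded)

    derived-expands : ∀ {a d i b t} {C : Conv b t} → Valid H a d i b → Derived i →
                      Σ (Conv a t) (Recall E₀ H (step a d i b C))
    derived-expands (original e _) d = ⊥-elim (d (∈-map⁺ idx e))
    derived-expands (derived-fwd {p = p} {σ} d h∈H eq (inst at)) _ =
      _ , here-fwd {p = p} {σ} d h∈H eq at (proj₂ (replace-defined _ p _ (proj₁ at)))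
    derived-expands (derived-bwd {p = p} {σ} d h∈H eq (inst at)) _ =
      _ , here-bwd {p = p} {σ} d h∈H eq at (proj₂ (replace-defined _ p _ (proj₁ at)))

    original-stuck : ∀ {a d i b t ℓ r} {C : Conv b t} → ie i ℓ r ∈ E₀ → RecallNF E₀ H C →
                     RecallNF E₀ H (step a d i b C)
    original-stuck e _ _ (here-fwd d _ _ _ _) = d (∈-map⁺ idx e)
    original-stuck e _ _ (here-bwd d _ _ _ _) = d (∈-map⁺ idx e)
    original-stuck e nf _ (there r) = nf _ r

    recall-progress : ∀ {s t} {C : Conv s t} → ValidConv C →
                      Σ (Conv s t) (Recall E₀ H C) ⊎ RecallNF E₀ H C
    recall-progress [] = inj₂ (λ _ ())
    recall-progress (original e _ ∷ vs) with recall-progress vs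
    ... | inj₁ (C' , r) = inj₁ (_ , there r)
    ... | inj₂ nf = inj₂ (original-stuck e nf)
    recall-progress (v@(derived-fwd d _ _ _) ∷ _) = inj₁ (derived-expands v d)
    recall-progress (v@(derived-bwd d _ _ _) ∷ _) = inj₁ (derived-expands v d)

    normal-form : ∀ {s t} (C : Conv s t) → Acc (λ C' C → Recall E₀ H C C') C → ValidConv C →
                  Σ (Conv s t) λ C' → Star (Recall E₀ H) C C' × RecallNF E₀ H C'
    normal-form C (acc rec) vs with recall-progress vs
    ... | inj₂ nf = C , ε , nf
    ... | inj₁ (C' , r) with normal-form C' (rec r) (recall-valid r vs)
    ... | C'' , rs , nf = C'' , r ◅ rs , nf

    normal-form-original : ∀ {s t} {C : Conv s t} → ValidConv C → RecallNF E₀ H C →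
                           E₀Conv E₀ C
    normal-form-original [] _ = []
    normal-form-original (original {p = p} {σ} e s ∷ vs) nf =
      eq-step {p = p} {σ} e (Data.Sum.map at at s) (normal-form-original vs (λ _ r → nf _ (there r)))
    normal-form-original (v@(derived-fwd d _ _ _) ∷ _) nf =
      ⊥-elim (nf _ (proj₂ (derived-expands v d)))
    normal-form-original (v@(derived-bwd d _ _ _) ∷ _) nf =
      ⊥-elim (nf _ (proj₂ (derived-expands v d)))

  original-conversion : ∀ {s t} {C : Conv s t} → E₀Conv E₀ C → EConv (unlabel E₀) s t
  original-conversion [] = ε
  original-conversion (trivial C) = original-conversion C
  original-conversion (eq-step {ℓ = ℓ} {r} {p} {σ} e s C) =
    Data.Sum.map E-step E-step s ◅ original-conversion C
    where
      E-step : ∀ {a b} → At p σ ℓ r a b → EStep (unlabel E₀) a b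
      E-step s = ℓ , r , ∈-map⁺ (λ e → IEq.lhs e , IEq.rhs e) e , p , σ , s

lemma2 : (F : Set) (ar : F → ℕ) (V : Set) →
    let open Rewriting F ar V in
    (_≻_ : Term → Term → Set) → IsReductionOrder _≻_ →
    (E₀ : List IEq) → Unique (map IEq.idx E₀) → All (λ e → IEq.idx e ≢ 0) E₀ →
    let open Completion _≻_ in
    (S : State) → Star _⇝_ (init E₀) S →
    ∀ {s t} (J : Conv s t) → IsJoin (State.rules S) J →
    Acc (λ C' C → Recall E₀ (State.hist S) C C') J
    × (∀ C → Star (Recall E₀ (State.hist S)) J C → RecallNF E₀ (State.hist S) C → E₀Conv E₀ C)
    × Σ (Conv s t) (λ C → Star (Recall E₀ (State.hist S)) J C × RecallNF E₀ (State.hist S) C)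
    × EConv (unlabel E₀) s t
lemma2 F ar V _≻_ _ E₀ distinct₀ _ S run {s} {t} J join =
  recall-terminates J , original-at-end , J-normal-form , E₀-conversion
  where
    open Rewriting F ar V
    open Completion _≻_
    open Recording F ar V _≻_ E₀
    H : List HEntry
    H = State.hist S

    I : InvariantS S
    I = run-invariant run (init-invariant distinct₀)

    open Recalling H (Invariant.recallable I)

    J-valid : ValidConv J
    J-valid = join-valid (Invariant.justifiedR I) join

    original-at-end : ∀ C → Star (Recall E₀ H) J C → RecallNF E₀ H C → E₀Conv E₀ C
    original-at-end C J↝C C-normal = normal-form-original (recalls-valid J↝C J-valid) C-normal

    J-normal-form : Σ (Conv s t) λ C → Star (Recall E₀ H) J C × RecallNF E₀ H C
    J-normal-form = normal-form J (recall-terminates J) J-valid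

    E₀-conversion : EConv (unlabel E₀) s t
    E₀-conversion with J-normal-form
    ... | C , J↝C , C-normal = original-conversion (original-at-end C J↝C C-normal)
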